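{- Let $G$ be a finite group and $\mathcal{A}\leq\mathbb{C}^\times$ a finite subgroup. Let $M$ be a square matrix with entries in $\mathcal{A}$ whose rows and columns are labelled by $G$. Then $M$ is cocyclic over $G$ if and only if there exist a normalised $2$-cocycle $\psi\colon G\times G\to\mathcal{A}$ and a matrix $\mathcal{A}$-equivalent to $M$ which lies in the centraliser algebra $\mathrm{C}(R_\psi)=\{X : XR_\psi(\gamma)=R_\psi(\gamma)X \text{ for all }\gamma\in\Gamma_\psi\}$, where $\Gamma_\psi$ and $R_\psi$ are as defined in the context.
   Context: A normalised $2$-cocycle is a map $\psi\colon G\times G\to\mathcal{A}$ with $\psi(g,1)=\psi(1,g)=1$ and $\psi(g,h)\psi(gh,k)=\psi(g,hk)\psi(h,k)$ for all $g,h,k\in G$. The central extension $\Gamma_\psi=(G,\mathcal{A},\psi)$ is the group with underlying set $\mathcal{A}\times G$ and multiplication $(a,g)(b,h)=(ab\psi(g,h),gh)$. The monomial representation $R_\psi$ of $\Gamma_\psi$ is $R_\psi(a,g)=a\,[\psi(x,g)\delta^{xg}_{y}]_{x,y\in G}$, rows and columns indexed by $G$ in a fixed ordering, $\delta$ the Kronecker delta. A matrix is monomial if it has exactly one nonzero entry in each row and column; matrices $M,M'$ are $\mathcal{A}$-equivalent if $M'=PMQ^\ast$ for monomial $P,Q$ with nonzero entries in $\mathcal{A}$. A matrix with entries in $\mathcal{A}$ is strictly cocyclic over $G$ if it equals $[\psi(x,y)\phi(xy)]_{x,y\in G}$ for some normalised $2$-cocycle $\psi\colon G\times G\to\mathcal{A}$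 and map $\phi\colon G\to\mathcal{A}$; it is cocyclic over $G$ if it is $\mathcal{A}$-equivalent to a strictly cocyclic matrix. -}

module Defs where

open import Data.Nat using (ℕ; suc; _+_; _∸_; _%_)
open import Data.Nat.DivMod using (m%n<n)
open import Data.Fin using (Fin; toℕ; fromℕ<; _≟_)
open import Data.Fin.Permutation using (Permutation′; _⟨$⟩ʳ_)
open import Data.Maybe using (Maybe; just; nothing)
open import Data.Product using (Σ; _×_; _,_; ∃)
open import Algebra.Structures using (IsGroup)
open import Relation.Binary.PropositionalEquality using (_≡_)
open import Relation.Nullary using (yes; no)

-- Every finite subgroup of ℂ^× of order n = suc N is the group μ_n of
-- n-th roots of unity; we represent ζ^j (ζ = e^{2πi/n}) by j : Fin n.
-- Multiplication of roots = addition of exponents mod n,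
-- inverse (= complex conjugate) = negation of exponents mod n.

Root : ℕ → Set
Root N = Fin (suc N)

module Roots (N : ℕ) where
  one : Root N
  one = fromℕ< (m%n<n 0 (suc N))

  infixl 7 _·_
  _·_ : Root N → Root N → Root N
  a · b = fromℕ< (m%n<n (toℕ a + toℕ b) (suc N))

  _⁻¹ᴬ : Root N → Root N
  a ⁻¹ᴬ = fromℕ< (m%n<n (suc N ∸ toℕ a) (suc N))

record FinGroup : Set where
  field
    order : ℕ
    _∙_   : Fin order → Fin order → Fin order
    ε     : Fin order
    _⁻¹   : Fin order → Fin order
    isGroup : IsGroup _≡_ _∙_ ε _⁻¹
  infixl 7 _∙_

El : FinGroup → Set
El G = Fin (FinGroup.order G)

module _ (G : FinGroup) (N : ℕ) where
  open FinGroup G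
  private
    El′ = El G
  open Roots N

  Matrix : Set
  Matrix = El′ → El′ → Root N

  record IsNormalisedCocycle (ψ : El′ → El′ → Root N) : Set where
    field
      normʳ   : ∀ g → ψ g ε ≡ one
      normˡ   : ∀ g → ψ ε g ≡ one
      cocycle : ∀ g h k → ψ g h · ψ (g ∙ h) k ≡ ψ g (h ∙ k) · ψ h k

  StrictlyCocyclic : Matrix → Set
  StrictlyCocyclic M =
    Σ (El′ → El′ → Root N) λ ψ → IsNormalisedCocycle ψ ×
    Σ (El′ → Root N) λ φ → ∀ x y → M x y ≡ ψ x y · φ (x ∙ y)

  -- A monomial matrix with nonzero entries in 𝒜 is given by a permutation
  -- σ and coefficients d: its (x,y) entry is d x if y = σ x, and 0 otherwise.
  -- M' = P M Q* with P = (σ , p), Q = (τ , q) unfolds to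
  --   M' x y = p x · M (σ x) (τ y) · (q y)⁻¹        (Q* = conjugate transpose)
  _≈𝒜_ : Matrix → Matrix → Set
  M' ≈𝒜 M =
    Σ (Permutation′ order) λ σ → Σ (El′ → Root N) λ p →
    Σ (Permutation′ order) λ τ → Σ (El′ → Root N) λ q →
    ∀ x y → M' x y ≡ p x · M (σ ⟨$⟩ʳ x) (τ ⟨$⟩ʳ y) · q y ⁻¹ᴬ

  Cocyclic : Matrix → Set
  Cocyclic M = Σ Matrix λ S → StrictlyCocyclic S × (S ≈𝒜 M)

  Γ : Set
  Γ = Root N × El′

  -- the monomial representation R_ψ(a,g) = a [ψ(x,g) δ^{xg}_y]  (0 = nothing)
  R : (El′ → El′ → Root N) → Γ → El′ → El′ → Maybe (Root N)
  R ψ (a , g) x y with x ∙ g ≟ y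
  ... | yes _ = just (a · ψ x g)
  ... | no  _ = nothing

  -- Since R_ψ(a,g) has in column y
  -- its only nonzero entry a ψ(y g⁻¹, g) in row y g⁻¹, and in row x its only
  -- nonzero entry a ψ(x,g) in column x g, the (x,y) entries are
  --   (X R)(x,y) = X(x, y g⁻¹) · a ψ(y g⁻¹, g),   (R X)(x,y) = a ψ(x,g) · X(x g, y).
  CommutesWithR : (El′ → El′ → Root N) → Matrix → Γ → Set
  CommutesWithR ψ X (a , g) =
    ∀ x y → X x (y ∙ g ⁻¹) · (a · ψ (y ∙ g ⁻¹) g) ≡ (a · ψ x g) · X (x ∙ g) y

  InCentraliser : (El′ → El′ → Root N) → Matrix → Set
  InCentraliser ψ X = ∀ (γ : Γ) → CommutesWithR ψ X γ

-- The centraliser C(R_ψ) consists exactly of the matrices [ψ(xy⁻¹, y)⁻¹ φ(xy⁻¹)]: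
-- commuting with R_ψ(1, y) determines every column of X from its column at 1,
-- and the cocycle identity shows that each such matrix commutes with all of R_ψ.
-- The cocycle identity at (x, y⁻¹, y) gives ψ(x, y⁻¹) ψ(xy⁻¹, y) = ψ(y⁻¹, y), so the
-- strictly cocyclic matrix [ψ(x, y)φ(xy)] turns into [ψ(xy⁻¹, y)⁻¹ φ(xy⁻¹)] (and back)
-- by moving column y⁻¹ to position y and rescaling it.  Permuting and rescaling
-- columns preserves 𝒜-equivalence, so each side of the equivalence yields the other
-- with the same ψ and φ(g) = X(g, 1).
module Submission where

open import Defs
open import Level using (0ℓ)
open import Data.Nat using (ℕ; suc; _+_; _∸_; _%_)
open import Data.Nat.Properties using (+-comm; +-assoc; m∸n+n≡m; <⇒≤)
open import Data.Nat.DivMod using (m%n<n; %-distribˡ-+; m%n%n≡m%n; m<n⇒m%n≡m; n%n≡0)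
open import Data.Fin using (toℕ)
open import Data.Fin.Properties using (toℕ-fromℕ<; toℕ-injective; toℕ<n)
open import Data.Fin.Permutation using (Permutation′; permutation; _∘ₚ_; _⟨$⟩ʳ_)
open import Data.Product using (Σ; _×_; _,_)
open import Function.Bundles using (_⇔_; mk⇔)
open import Relation.Binary.PropositionalEquality
  using (_≡_; refl; sym; trans; cong; cong₂; isEquivalence; module ≡-Reasoning)
open import Algebra.Bundles using (Group; AbelianGroup)
open import Algebra.Structures using (IsGroup)
import Algebra.Properties.Group as GroupProperties
import Algebra.Properties.AbelianGroup as AbelianGroupProperties
import Algebra.Solver.CommutativeMonoid as CommutativeMonoidSolver

module _ (N : ℕ) where
  open Roots N
  open ≡-Reasoning

  private
    n : ℕ
    n = suc N

    toℕ-· : ∀ a b → toℕ (a · b) ≡ (toℕ a + toℕ b) % n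
    toℕ-· a b = toℕ-fromℕ< _

    [m%n+o]%n≡[m+o]%n : ∀ m o → (m % n + o) % n ≡ (m + o) % n
    [m%n+o]%n≡[m+o]%n m o = begin
      (m % n + o) % n          ≡⟨ %-distribˡ-+ (m % n) o n ⟩
      (m % n % n + o % n) % n  ≡⟨ cong (λ i → (i + o % n) % n) (m%n%n≡m%n m n) ⟩
      (m % n + o % n) % n      ≡⟨ %-distribˡ-+ m o n ⟨
      (m + o) % n              ∎

    ·-comm : ∀ a b → a · b ≡ b · a
    ·-comm a b = toℕ-injective (begin
      toℕ (a · b)            ≡⟨ toℕ-· a b ⟩
      (toℕ a + toℕ b) % n    ≡⟨ cong (_% n) (+-comm (toℕ a) (toℕ b)) ⟩
      (toℕ b + toℕ a) % n    ≡⟨ toℕ-· b a ⟨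
      toℕ (b · a)            ∎)

    [m+o%n]%n≡[m+o]%n : ∀ m o → (m + o % n) % n ≡ (m + o) % n
    [m+o%n]%n≡[m+o]%n m o = begin
      (m + o % n) % n  ≡⟨ cong (_% n) (+-comm m (o % n)) ⟩
      (o % n + m) % n  ≡⟨ [m%n+o]%n≡[m+o]%n o m ⟩
      (o + m) % n      ≡⟨ cong (_% n) (+-comm o m) ⟩
      (m + o) % n      ∎

    ·-assoc : ∀ a b c → (a · b) · c ≡ a · (b · c)
    ·-assoc a b c = toℕ-injective (begin
      toℕ ((a · b) · c)                   ≡⟨ toℕ-· (a · b) c ⟩
      (toℕ (a · b) + toℕ c) % n           ≡⟨ cong (λ i → (i + toℕ c) % n) (toℕ-· a b) ⟩
      ((toℕ a + toℕ b) % n + toℕ c) % n   ≡⟨ [m%n+o]%n≡[m+o]%n (toℕ a + toℕ b) (toℕ c) ⟩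
      (toℕ a + toℕ b + toℕ c) % n         ≡⟨ cong (_% n) (+-assoc (toℕ a) (toℕ b) (toℕ c)) ⟩
      (toℕ a + (toℕ b + toℕ c)) % n       ≡⟨ [m+o%n]%n≡[m+o]%n (toℕ a) (toℕ b + toℕ c) ⟨
      (toℕ a + (toℕ b + toℕ c) % n) % n   ≡⟨ cong (λ i → (toℕ a + i) % n) (toℕ-· b c) ⟨
      (toℕ a + toℕ (b · c)) % n           ≡⟨ toℕ-· a (b · c) ⟨
      toℕ (a · (b · c))                   ∎)

    ·-identityˡ : ∀ a → one · a ≡ a
    ·-identityˡ a = toℕ-injective (trans (toℕ-· one a) (m<n⇒m%n≡m (toℕ<n a)))

    ⁻¹ᴬ-inverseˡ : ∀ a → a ⁻¹ᴬ · a ≡ one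
    ⁻¹ᴬ-inverseˡ a = toℕ-injective (begin
      toℕ (a ⁻¹ᴬ · a)                ≡⟨ toℕ-· (a ⁻¹ᴬ) a ⟩
      (toℕ (a ⁻¹ᴬ) + toℕ a) % n      ≡⟨ cong (λ i → (i + toℕ a) % n) (toℕ-fromℕ< (m%n<n (n ∸ toℕ a) n)) ⟩
      ((n ∸ toℕ a) % n + toℕ a) % n  ≡⟨ [m%n+o]%n≡[m+o]%n (n ∸ toℕ a) (toℕ a) ⟩
      (n ∸ toℕ a + toℕ a) % n        ≡⟨ cong (_% n) (m∸n+n≡m (<⇒≤ (toℕ<n a))) ⟩
      n % n                          ≡⟨ n%n≡0 n ⟩
      0                              ∎)

  rootGroup : AbelianGroup 0ℓ 0ℓ
  rootGroup = record
    { Carrier = Root N ; _≈_ = _≡_ ; _∙_ = _·_ ; ε = one ; _⁻¹ = _⁻¹ᴬ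
    ; isAbelianGroup = record
      { isGroup = record
        { isMonoid = record
          { isSemigroup = record
            { isMagma = record { isEquivalence = isEquivalence ; ∙-cong = cong₂ _·_ }
            ; assoc = ·-assoc }
          ; identity = ·-identityˡ , λ a → trans (·-comm a one) (·-identityˡ a) }
        ; inverse = ⁻¹ᴬ-inverseˡ , λ a → trans (·-comm a (a ⁻¹ᴬ)) (⁻¹ᴬ-inverseˡ a)
        ; ⁻¹-cong = cong _⁻¹ᴬ }
      ; comm = ·-comm } }

module _ {a ℓ} (𝒜 : AbelianGroup a ℓ) where
  open AbelianGroup 𝒜
    using (_≈_; _∙_; _⁻¹; ε; setoid; commutativeMonoid; ∙-congˡ; ∙-congʳ; inverseˡ; identityˡ)
    renaming (sym to ≈-sym; refl to ≈-refl)
  open AbelianGroupProperties 𝒜 using (y≈x\\z)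
  open CommutativeMonoidSolver commutativeMonoid using (solve; _⊕_; _⊜_)
  open import Relation.Binary.Reasoning.Setoid setoid

  x∙y≈z∙w⇒x⁻¹∙w≈y∙z⁻¹ : ∀ x y z w → x ∙ y ≈ z ∙ w → x ⁻¹ ∙ w ≈ y ∙ z ⁻¹
  x∙y≈z∙w⇒x⁻¹∙w≈y∙z⁻¹ x y z w xy≈zw = begin
    x ⁻¹ ∙ w                 ≈⟨ ∙-congˡ (y≈x\\z z w (x ∙ y) (≈-sym xy≈zw)) ⟩
    x ⁻¹ ∙ (z ⁻¹ ∙ (x ∙ y))  ≈⟨ solve 4 (λ x′ z′ x y → x′ ⊕ (z′ ⊕ (x ⊕ y)) ⊜ (x′ ⊕ x) ⊕ (y ⊕ z′))
                                   ≈-refl (x ⁻¹) (z ⁻¹) x y ⟩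
    x ⁻¹ ∙ x ∙ (y ∙ z ⁻¹)    ≈⟨ ∙-congʳ (inverseˡ x) ⟩
    ε ∙ (y ∙ z ⁻¹)           ≈⟨ identityˡ _ ⟩
    y ∙ z ⁻¹                 ∎

finGroup : FinGroup → Group 0ℓ 0ℓ
finGroup G = record { isGroup = FinGroup.isGroup G }

module _ (G : FinGroup) (N : ℕ) where
  open FinGroup G
  open IsGroup isGroup using (assoc; inverseˡ; inverseʳ)
  open Roots N
  open ≡-Reasoning
  private
    module 𝒜 = AbelianGroup (rootGroup N)
    module GP = GroupProperties (finGroup G)
    module AP = AbelianGroupProperties (rootGroup N)
  open CommutativeMonoidSolver 𝒜.commutativeMonoid using (solve; _⊕_; _⊜_)

  inversion : Permutation′ order
  inversion = permutation _⁻¹ _⁻¹ GP.⁻¹-involutive GP.⁻¹-involutive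

  ≈𝒜-invertColumns : ∀ {M} (X Y : Matrix G N) (c : El G → Root N) →
    (∀ x y → X x y ≡ Y x (y ⁻¹) · c y) → _≈𝒜_ G N Y M → _≈𝒜_ G N X M
  ≈𝒜-invertColumns {M} X Y c X≡ (σ , p , τ , q , Y≡) =
    σ , p , inversion ∘ₚ τ , (λ y → q (y ⁻¹) · c y ⁻¹ᴬ) , X≡PMQ*
    where
    X≡PMQ* : ∀ x y → X x y ≡ p x · M (σ ⟨$⟩ʳ x) (τ ⟨$⟩ʳ (y ⁻¹)) · (q (y ⁻¹) · c y ⁻¹ᴬ) ⁻¹ᴬ
    X≡PMQ* x y = begin
      X x y                       ≡⟨ X≡ x y ⟩
      Y x (y ⁻¹) · c y            ≡⟨ cong (_· c y) (Y≡ x (y ⁻¹)) ⟩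
      p x · m · q′ ⁻¹ᴬ · c y      ≡⟨ solve 4 (λ p m q c → ((p ⊕ m) ⊕ q) ⊕ c ⊜ (p ⊕ m) ⊕ (c ⊕ q))
                                       refl (p x) m (q′ ⁻¹ᴬ) (c y) ⟩
      p x · m · (c y · q′ ⁻¹ᴬ)    ≡⟨ cong (p x · m ·_) (AP.⁻¹-anti-homo-// q′ (c y)) ⟨
      p x · m · (q′ · c y ⁻¹ᴬ) ⁻¹ᴬ ∎
      where
      m  = M (σ ⟨$⟩ʳ x) (τ ⟨$⟩ʳ (y ⁻¹))
      q′ = q (y ⁻¹)

  strictlyCocyclicMatrix : (El G → El G → Root N) → (El G → Root N) → Matrix G N
  strictlyCocyclicMatrix ψ φ x y = ψ x y · φ (x ∙ y)

  centraliserMatrix : (El G → El G → Root N) → (El G → Root N) → Matrix G N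
  centraliserMatrix ψ φ x y = ψ (x ∙ y ⁻¹) y ⁻¹ᴬ · φ (x ∙ y ⁻¹)

  module _ {ψ : El G → El G → Root N} (isCocycle : IsNormalisedCocycle G N ψ) where
    open IsNormalisedCocycle isCocycle

    cocycle-⁻¹ : ∀ x y → ψ x (y ⁻¹) · ψ (x ∙ y ⁻¹) y ≡ ψ (y ⁻¹) y
    cocycle-⁻¹ x y = begin
      ψ x (y ⁻¹) · ψ (x ∙ y ⁻¹) y  ≡⟨ cocycle x (y ⁻¹) y ⟩
      ψ x (y ⁻¹ ∙ y) · ψ (y ⁻¹) y  ≡⟨ cong (λ g → ψ x g · ψ (y ⁻¹) y) (inverseˡ y) ⟩
      ψ x ε · ψ (y ⁻¹) y           ≡⟨ cong (_· ψ (y ⁻¹) y) (normʳ x) ⟩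
      one · ψ (y ⁻¹) y             ≡⟨ 𝒜.identityˡ (ψ (y ⁻¹) y) ⟩
      ψ (y ⁻¹) y                   ∎

    strictlyCocyclicMatrix-⁻¹ : ∀ φ x y →
      strictlyCocyclicMatrix ψ φ x (y ⁻¹) ≡ centraliserMatrix ψ φ x y · ψ (y ⁻¹) y
    strictlyCocyclicMatrix-⁻¹ φ x y = begin
      ψ x (y ⁻¹) · φ u
        ≡⟨ cong (_· φ u) (AP.x≈z//y (ψ x (y ⁻¹)) (ψ u y) (ψ (y ⁻¹) y) (cocycle-⁻¹ x y)) ⟩
      ψ (y ⁻¹) y · ψ u y ⁻¹ᴬ · φ u
        ≡⟨ solve 3 (λ a b f → (a ⊕ b) ⊕ f ⊜ (b ⊕ f) ⊕ a) refl (ψ (y ⁻¹) y) (ψ u y ⁻¹ᴬ) (φ u) ⟩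
      ψ u y ⁻¹ᴬ · φ u · ψ (y ⁻¹) y ∎
      where u = x ∙ y ⁻¹

    centraliserMatrix-inCentraliser : ∀ φ → InCentraliser G N ψ (centraliserMatrix ψ φ)
    centraliserMatrix-inCentraliser φ (a , g) x y = begin
      ψ u w ⁻¹ᴬ · φ u · (a · ψ w g)
        ≡⟨ solve 4 (λ A f a D → (A ⊕ f) ⊕ (a ⊕ D) ⊜ (a ⊕ f) ⊕ (A ⊕ D))
             refl (ψ u w ⁻¹ᴬ) (φ u) a (ψ w g) ⟩
      a · φ u · (ψ u w ⁻¹ᴬ · ψ w g)
        ≡⟨ cong (a · φ u ·_)
             (x∙y≈z∙w⇒x⁻¹∙w≈y∙z⁻¹ (rootGroup N) (ψ u w) (ψ x g) (ψ u y) (ψ w g) shifted-cocycle) ⟩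
      a · φ u · (ψ x g · ψ u y ⁻¹ᴬ)
        ≡⟨ solve 4 (λ a f B C → (a ⊕ f) ⊕ (B ⊕ C) ⊜ (a ⊕ B) ⊕ (C ⊕ f))
             refl a (φ u) (ψ x g) (ψ u y ⁻¹ᴬ) ⟩
      a · ψ x g · (ψ u y ⁻¹ᴬ · φ u)
        ≡⟨ cong (λ v → a · ψ x g · (ψ v y ⁻¹ᴬ · φ v)) u≡xgy⁻¹ ⟩
      a · ψ x g · centraliserMatrix ψ φ (x ∙ g) y ∎
      where
      w = y ∙ g ⁻¹
      u = x ∙ w ⁻¹
      u≡xgy⁻¹ : u ≡ x ∙ g ∙ y ⁻¹
      u≡xgy⁻¹ = trans (cong (x ∙_) (GP.⁻¹-anti-homo-// y g)) (sym (assoc x g (y ⁻¹)))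
      shifted-cocycle : ψ u w · ψ x g ≡ ψ u y · ψ w g
      shifted-cocycle = begin
        ψ u w · ψ x g        ≡⟨ cong (λ v → ψ u w · ψ v g) (GP.//-rightDividesˡ w x) ⟨
        ψ u w · ψ (u ∙ w) g  ≡⟨ cocycle u w g ⟩
        ψ u (w ∙ g) · ψ w g  ≡⟨ cong (λ v → ψ u v · ψ w g) (GP.//-rightDividesˡ g y) ⟩
        ψ u y · ψ w g        ∎

    inCentraliser⇒column-ε : ∀ X → InCentraliser G N ψ X → ∀ u y → ψ u y · X (u ∙ y) y ≡ X u ε
    inCentraliser⇒column-ε X X∈C u y = begin
      ψ u y · X (u ∙ y) y                    ≡⟨ cong (_· X (u ∙ y) y) (𝒜.identityˡ (ψ u y)) ⟨
      one · ψ u y · X (u ∙ y) y              ≡⟨ X∈C (one , y) u y ⟨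
      X u (y ∙ y ⁻¹) · (one · ψ (y ∙ y ⁻¹) y) ≡⟨ cong (λ e → X u e · (one · ψ e y)) (inverseʳ y) ⟩
      X u ε · (one · ψ ε y)                  ≡⟨ cong (λ r → X u ε · (one · r)) (normˡ y) ⟩
      X u ε · (one · one)                    ≡⟨ cong (X u ε ·_) (𝒜.identityˡ one) ⟩
      X u ε · one                            ≡⟨ 𝒜.identityʳ (X u ε) ⟩
      X u ε                                  ∎

    inCentraliser⇒≡centraliserMatrix : ∀ X → InCentraliser G N ψ X →
      ∀ x y → X x y ≡ centraliserMatrix ψ (λ u → X u ε) x y
    inCentraliser⇒≡centraliserMatrix X X∈C x y = begin
      X x y          ≡⟨ cong (λ v → X v y) (GP.//-rightDividesˡ y x) ⟨
      X (u ∙ y) y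
        ≡⟨ AP.y≈x\\z (ψ u y) (X (u ∙ y) y) (X u ε) (inCentraliser⇒column-ε X X∈C u y) ⟩
      ψ u y ⁻¹ᴬ · X u ε ∎
      where u = x ∙ y ⁻¹

  module _ (M : Matrix G N) where
    cocyclic⇒centraliser : Cocyclic G N M →
      Σ (El G → El G → Root N) λ ψ → IsNormalisedCocycle G N ψ ×
        (Σ (Matrix G N) λ X → _≈𝒜_ G N X M × InCentraliser G N ψ X)
    cocyclic⇒centraliser (S , (ψ , isCocycle , φ , S≡) , S≈M) =
      ψ , isCocycle , centraliserMatrix ψ φ ,
      ≈𝒜-invertColumns {M} (centraliserMatrix ψ φ) S (λ y → ψ (y ⁻¹) y ⁻¹ᴬ) C≡ S≈M ,
      centraliserMatrix-inCentraliser isCocycle φ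
      where
      C≡ : ∀ x y → centraliserMatrix ψ φ x y ≡ S x (y ⁻¹) · ψ (y ⁻¹) y ⁻¹ᴬ
      C≡ x y = AP.x≈z//y (centraliserMatrix ψ φ x y) (ψ (y ⁻¹) y) (S x (y ⁻¹))
                 (sym (trans (S≡ x (y ⁻¹)) (strictlyCocyclicMatrix-⁻¹ isCocycle φ x y)))

    centraliser⇒cocyclic :
      (Σ (El G → El G → Root N) λ ψ → IsNormalisedCocycle G N ψ ×
        (Σ (Matrix G N) λ X → _≈𝒜_ G N X M × InCentraliser G N ψ X)) →
      Cocyclic G N M
    centraliser⇒cocyclic (ψ , isCocycle , X , X≈M , X∈C) =
      strictlyCocyclicMatrix ψ φ , (ψ , isCocycle , φ , λ _ _ → refl) ,
      ≈𝒜-invertColumns {M} (strictlyCocyclicMatrix ψ φ) X (λ y → ψ y (y ⁻¹)) S≡ X≈M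
      where
      φ : El G → Root N
      φ u = X u ε
      S≡ : ∀ x y → strictlyCocyclicMatrix ψ φ x y ≡ X x (y ⁻¹) · ψ y (y ⁻¹)
      S≡ x y = begin
        strictlyCocyclicMatrix ψ φ x y
          ≡⟨ cong (strictlyCocyclicMatrix ψ φ x) (GP.⁻¹-involutive y) ⟨
        strictlyCocyclicMatrix ψ φ x (y ⁻¹ ⁻¹)
          ≡⟨ strictlyCocyclicMatrix-⁻¹ isCocycle φ x (y ⁻¹) ⟩
        centraliserMatrix ψ φ x (y ⁻¹) · ψ (y ⁻¹ ⁻¹) (y ⁻¹)
          ≡⟨ cong₂ _·_ (sym (inCentraliser⇒≡centraliserMatrix isCocycle X X∈C x (y ⁻¹)))
                       (cong (λ v → ψ v (y ⁻¹)) (GP.⁻¹-involutive y)) ⟩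
        X x (y ⁻¹) · ψ y (y ⁻¹) ∎

theorem4p4 : (G : FinGroup) (N : ℕ) (M : Matrix G N) →
    Cocyclic G N M ⇔
      (Σ (El G → El G → Root N) λ ψ → IsNormalisedCocycle G N ψ ×
        (Σ (Matrix G N) λ X → _≈𝒜_ G N X M × InCentraliser G N ψ X))
theorem4p4 G N M = mk⇔ (cocyclic⇒centraliser G N M) (centraliser⇒cocyclic G N M)
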